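{- Let $\mathbb K$ be a field of characteristic $0$, let $p\in\mathbb K$, let $f:\mathbb N\to\mathbb K$, and let $d\in\mathbb Z$ with $d<0$. Then in the ring $\mathbb K[[x]]$ of formal power series $$\sum_{n=1}^\infty x^n\frac{(p)_n}{(n+d)!}\sum_{i=1}^n f(i)=\frac{(1-x)^{d-p}}{x^d}\left((p)_{ -d}\sum_{i=1}^{ -d}f(i)+\int_0^x\frac{(1-t)^{p-d-1}}{t^{1-d}}\sum_{n=1}^\infty t^n\frac{(p)_n}{(n+d-1)!}f(n)\,dt\right).$$
   Context: $(p)_n=p(p+1)\cdots(p+n-1)$ denotes the Pochhammer symbol, and $1/m!$ is taken to be $0$ when $m<0$. -}

module Defs where

open import Level using (Level; _⊔_) renaming (suc to lsuc)
open import Algebra.Bundles using (CommutativeRing)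
open import Data.Nat as ℕ using (ℕ; zero; suc; _!; NonZero)
open import Data.Nat.Properties using (_!≢0)
open import Data.Integer as ℤ using (ℤ; +_; -[1+_])
open import Data.Bool using (if_then_else_)
open import Relation.Nullary using (¬_)

record Field (c ℓ : Level) : Set (lsuc (c ⊔ ℓ)) where
  field
    commutativeRing : CommutativeRing c ℓ
  open CommutativeRing commutativeRing public
  field
    0≉1   : ¬ (0# ≈ 1#)
    inv   : (x : Carrier) → ¬ (x ≈ 0#) → Carrier
    inv-r : (x : Carrier) (h : ¬ (x ≈ 0#)) → (x * inv x h) ≈ 1#

module FieldOps {c ℓ : Level} (K : Field c ℓ) where
  open Field K hiding (zero)

  ιℕ : ℕ → Carrier
  ιℕ zero    = 0#
  ιℕ (suc n) = 1# + ιℕ n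

  ιℤ : ℤ → Carrier
  ιℤ (+ n)      = ιℕ n
  ιℤ -[1+ n ]   = - ιℕ (suc n)

CharZero : {c ℓ : Level} → Field c ℓ → Set ℓ
CharZero K = (n : ℕ) → ¬ (ιℕ (suc n) ≈ 0#)
  where open Field K hiding (zero)
        open FieldOps K

module PowerSeries {c ℓ : Level} (K : Field c ℓ) (ch : CharZero K) where
  open Field K hiding (zero)
  open FieldOps K public

  PS : Set c
  PS = ℕ → Carrier

  infix 4 _≋_
  _≋_ : PS → PS → Set ℓ
  F ≋ G = (n : ℕ) → F n ≈ G n

  ιℕ-nz : (m : ℕ) → .{{NonZero m}} → ¬ (ιℕ m ≈ 0#)
  ιℕ-nz (suc k) = ch k

  invFactℕ : ℕ → Carrier
  invFactℕ m = inv (ιℕ (m !)) (ιℕ-nz (m !) {{m !≢0}})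

  -- 1 / m!  for an integer m, with the convention 1/m! = 0 when m < 0
  invFact : ℤ → Carrier
  invFact (+ m)     = invFactℕ m
  invFact -[1+ _ ]  = 0#

  invSuc : ℕ → Carrier
  invSuc n = inv (ιℕ (suc n)) (ch n)

  poch : Carrier → ℕ → Carrier
  poch p zero    = 1#
  poch p (suc n) = poch p n * (p + ιℕ n)

  falling : Carrier → ℕ → Carrier
  falling α zero    = 1#
  falling α (suc k) = falling α k * (α - ιℕ k)

  sign : ℕ → Carrier
  sign zero    = 1#
  sign (suc k) = - sign k

  sum1 : ℕ → (ℕ → Carrier) → Carrier
  sum1 zero    g = 0#
  sum1 (suc n) g = sum1 n g + g (suc n)

  sum0 : ℕ → (ℕ → Carrier) → Carrier
  sum0 zero    g = g zero
  sum0 (suc n) g = sum0 n g + g (suc n)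

  seriesFrom1 : (ℕ → Carrier) → PS
  seriesFrom1 a zero    = 0#
  seriesFrom1 a (suc n) = a (suc n)

  const : Carrier → PS
  const a zero    = a
  const a (suc n) = 0#

  _⊕_ : PS → PS → PS
  (F ⊕ G) n = F n + G n

  _⊛_ : PS → PS → PS
  (F ⊛ G) n = sum0 n (λ i → F i * G (n ℕ.∸ i))

  mulXPow : ℕ → PS → PS
  mulXPow m F n = if n ℕ.<ᵇ m then 0# else F (n ℕ.∸ m)

  -- division by x^m: the series whose coefficients are those of F shifted
  -- down by m (this is F / x^m whenever x^m divides F)
  divXPow : ℕ → PS → PS
  divXPow m F n = F (n ℕ.+ m)

  -- (1 - x)^α = Σ_k binom(α,k) (-x)^k, binom(α,k) = α(α-1)...(α-k+1)/k!
  oneMinusXPow : Carrier → PS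
  oneMinusXPow α k = sign k * (falling α k * invFactℕ k)

  integral : PS → PS
  integral F zero    = 0#
  integral F (suc n) = F n * invSuc n

module Submission where

open import Defs
open import Level using (Level)
open import Data.Nat using (ℕ)
open import Data.Integer using (ℤ; +_; _<_; ∣_∣) renaming (-_ to -ℤ_; _+_ to _+ℤ_; _-_ to _-ℤ_)
open import Algebra.Solver.Ring.AlmostCommutativeRing
  using (AlmostCommutativeRing; fromCommutativeRing; _-Raw-AlmostCommutative⟶_)
open import Data.Nat as ℕ using (zero; suc; _!; z≤n; s≤s)
import Data.Nat.Properties as ℕP
open import Data.Integer as ℤ using (-[1+_]; _⊖_)
import Data.Integer.Properties as ℤP
open import Data.Bool using (T; true; false)
open import Data.Maybe using (Maybe; just; nothing)
open import Data.Sum using (inj₁; inj₂)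
open import Data.Unit using (tt)
open import Relation.Nullary using (¬_; yes; no)
open import Relation.Binary.PropositionalEquality as P using (_≡_)

-- Put D = -d > 0 and μ = p - d = p + D.  Shifting the left side
-- down by D gives the series  M(m) = (p)_{m+D}/m! · Σ_{i≤m+D} f(i),  and the
-- recursion of the Pochhammer symbol shows that M solves the first-order equation
--     (1 - x) M′ = μ M + g,    g(m) = (p)_{m+D+1}/m! · f(m+D+1),
-- i.e. (n+1) M(n+1) = (n+μ) M(n) + g(n); in characteristic 0 such a recurrence
-- determines a series from its constant term.  The right side divided by x^D is
-- U J with U = (1-x)^{d-p}, J = c + ∫ Q and Q = (1-x)^{p-d-1} g.  Since (1-x)^a
-- solves (1-x) Y′ = -a Y and (1-x) d/dx is a derivation, U J solves
-- (1-x) Y′ = μ U J + U (1-x) Q, and the exponent law (1-x)^a (1-x)^b = (1-x)^{a+b}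
-- gives U (1-x) Q = g.  Both series have constant term (p)_D Σ_{i≤D} f(i), so U J = M.

-- The canonical map ℤ → K is a ring homomorphism; this makes K a ring
-- with integer coefficients, so the ring solver can normalise identities
-- in K that involve integer constants.
module IntegerCoefficients {c ℓ : Level} (K : Field c ℓ) where
  open Field K hiding (zero)
  open FieldOps K
  open import Relation.Binary.Reasoning.Setoid setoid
  open import Algebra.Properties.Ring ring
    using (-‿distribˡ-*; -‿distribʳ-*; -‿involutive; -‿+-comm; -0#≈0#)
  open import Algebra.Properties.Semiring.Mult semiring using (_×_; ×-homo-+; ×1-homo-*)

  ιℕ≈× : ∀ n → ιℕ n ≈ n × 1#
  ιℕ≈× zero    = refl
  ιℕ≈× (suc n) = +-congˡ (ιℕ≈× n)

  ιℕ-+ : ∀ m n → ιℕ (m ℕ.+ n) ≈ ιℕ m + ιℕ n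
  ιℕ-+ m n = begin
    ιℕ (m ℕ.+ n)        ≈⟨ ιℕ≈× (m ℕ.+ n) ⟩
    (m ℕ.+ n) × 1#      ≈⟨ ×-homo-+ 1# m n ⟩
    m × 1# + n × 1#     ≈⟨ +-cong (ιℕ≈× m) (ιℕ≈× n) ⟨
    ιℕ m + ιℕ n         ∎

  ιℕ-* : ∀ m n → ιℕ (m ℕ.* n) ≈ ιℕ m * ιℕ n
  ιℕ-* m n = begin
    ιℕ (m ℕ.* n)        ≈⟨ ιℕ≈× (m ℕ.* n) ⟩
    (m ℕ.* n) × 1#      ≈⟨ ×1-homo-* m n ⟩
    m × 1# * n × 1#     ≈⟨ *-cong (ιℕ≈× m) (ιℕ≈× n) ⟨
    ιℕ m * ιℕ n         ∎

  ιℤ-neg : ∀ i → ιℤ (ℤ.- i) ≈ - ιℤ i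
  ιℤ-neg (+ zero)  = sym -0#≈0#
  ιℤ-neg (+ suc n) = refl
  ιℤ-neg -[1+ n ]  = sym (-‿involutive _)

  ιℤ-⊖ : ∀ m n → ιℤ (m ⊖ n) ≈ ιℕ m - ιℕ n
  ιℤ-⊖ zero    zero    = sym (-‿inverseʳ 0#)
  ιℤ-⊖ zero    (suc n) = sym (+-identityˡ _)
  ιℤ-⊖ (suc m) zero    = sym (trans (+-congˡ -0#≈0#) (+-identityʳ _))
  ιℤ-⊖ (suc m) (suc n) = begin
    ιℤ (suc m ⊖ suc n)            ≡⟨ P.cong ιℤ (ℤP.[1+m]⊖[1+n]≡m⊖n m n) ⟩
    ιℤ (m ⊖ n)                    ≈⟨ ιℤ-⊖ m n ⟩
    ιℕ m - ιℕ n                   ≈⟨ +-congʳ (+-identityˡ _) ⟨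
    (0# + ιℕ m) - ιℕ n            ≈⟨ +-congʳ (+-congʳ (-‿inverseˡ 1#)) ⟨
    (- 1# + 1# + ιℕ m) - ιℕ n     ≈⟨ +-congʳ (+-assoc _ _ _) ⟩
    (- 1# + ιℕ (suc m)) - ιℕ n    ≈⟨ +-congʳ (+-comm _ _) ⟩
    (ιℕ (suc m) - 1#) - ιℕ n      ≈⟨ +-assoc _ _ _ ⟩
    ιℕ (suc m) + (- 1# - ιℕ n)    ≈⟨ +-congˡ (-‿+-comm _ _) ⟩
    ιℕ (suc m) - ιℕ (suc n)       ∎

  ιℤ-+ : ∀ i j → ιℤ (i ℤ.+ j) ≈ ιℤ i + ιℤ j
  ιℤ-+ (+ m)    (+ n)    = ιℕ-+ m n
  ιℤ-+ (+ m)    -[1+ n ] = ιℤ-⊖ m (suc n)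
  ιℤ-+ -[1+ m ] (+ n)    = trans (ιℤ-⊖ n (suc m)) (+-comm _ _)
  ιℤ-+ -[1+ m ] -[1+ n ] = begin
    - ιℕ (suc (suc (m ℕ.+ n)))    ≡⟨ P.cong (λ k → - ιℕ (suc k)) (ℕP.+-suc m n) ⟨
    - ιℕ (suc m ℕ.+ suc n)        ≈⟨ -‿cong (ιℕ-+ (suc m) (suc n)) ⟩
    - (ιℕ (suc m) + ιℕ (suc n))   ≈⟨ -‿+-comm _ _ ⟨
    - ιℕ (suc m) - ιℕ (suc n)     ∎

  ιℤ-*-+ : ∀ i n → ιℤ (i ℤ.* + n) ≈ ιℤ i * ιℕ n
  ιℤ-*-+ (+ m)    n = P.subst (λ z → ιℤ z ≈ ιℕ m * ιℕ n) (ℤP.pos-* m n) (ιℕ-* m n)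
  ιℤ-*-+ -[1+ m ] n = begin
    ιℤ (-[1+ m ] ℤ.* + n)          ≡⟨ P.cong ιℤ (ℤP.neg-distribˡ-* (+ suc m) (+ n)) ⟨
    ιℤ (ℤ.- (+ suc m ℤ.* + n))     ≈⟨ ιℤ-neg (+ suc m ℤ.* + n) ⟩
    - ιℤ (+ suc m ℤ.* + n)         ≈⟨ -‿cong (ιℤ-*-+ (+ suc m) n) ⟩
    - (ιℕ (suc m) * ιℕ n)          ≈⟨ -‿distribˡ-* _ _ ⟩
    - ιℕ (suc m) * ιℕ n            ∎

  ιℤ-* : ∀ i j → ιℤ (i ℤ.* j) ≈ ιℤ i * ιℤ j
  ιℤ-* i (+ n)    = ιℤ-*-+ i n
  ιℤ-* i -[1+ n ] = begin
    ιℤ (i ℤ.* -[1+ n ])            ≡⟨ P.cong ιℤ (ℤP.neg-distribʳ-* i (+ suc n)) ⟨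
    ιℤ (ℤ.- (i ℤ.* + suc n))       ≈⟨ ιℤ-neg (i ℤ.* + suc n) ⟩
    - ιℤ (i ℤ.* + suc n)           ≈⟨ -‿cong (ιℤ-*-+ i (suc n)) ⟩
    - (ιℤ i * ιℕ (suc n))          ≈⟨ -‿distribʳ-* _ _ ⟩
    ιℤ i * - ιℕ (suc n)            ∎

  private
    K′ : AlmostCommutativeRing c ℓ
    K′ = fromCommutativeRing commutativeRing

    ιℤ-homomorphism : ℤ.+-*-rawRing -Raw-AlmostCommutative⟶ K′
    ιℤ-homomorphism = record
      { ⟦_⟧ = ιℤ ; +-homo = ιℤ-+ ; *-homo = ιℤ-* ; -‿homo = ιℤ-neg
      ; 0-homo = refl ; 1-homo = +-identityʳ 1# }

    ιℤ-≟ : ∀ i j → Maybe (ιℤ i ≈ ιℤ j)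
    ιℤ-≟ i j with i ℤ.≟ j
    ... | yes P.refl = just refl
    ... | no _       = nothing

  open import Algebra.Solver.Ring ℤ.+-*-rawRing K′ ιℤ-homomorphism ιℤ-≟ public

⊖-shift : ∀ m s → (m ℕ.+ s) ⊖ s ≡ + m
⊖-shift m s = P.trans (ℤP.⊖-≥ (ℕP.m≤n+m s m)) (P.cong +_ (ℕP.m+n∸n≡m m s))

module FormalSeries {c ℓ : Level} (K : Field c ℓ) (ch : CharZero K) where
  open Field K hiding (zero)
  open PowerSeries K ch
  open IntegerCoefficients K
  open import Relation.Binary.Reasoning.Setoid setoid

  *-cancelˡ : ∀ {a x y} → ¬ (a ≈ 0#) → a * x ≈ a * y → x ≈ y
  *-cancelˡ {a} {x} {y} a≉0 ax≈ay = begin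
    x                 ≈⟨ undo x ⟩
    a⁻¹ * (a * x)     ≈⟨ *-congˡ ax≈ay ⟩
    a⁻¹ * (a * y)     ≈⟨ undo y ⟨
    y                 ∎
    where
    a⁻¹ = inv a a≉0
    undo : ∀ z → z ≈ a⁻¹ * (a * z)
    undo z = sym (trans (sym (*-assoc _ _ _))
               (trans (*-congʳ (trans (*-comm _ _) (inv-r a a≉0))) (*-identityˡ z)))

  inv-unique : ∀ {a z} (a≉0 : ¬ (a ≈ 0#)) → a * z ≈ 1# → inv a a≉0 ≈ z
  inv-unique {a} a≉0 az≈1 = *-cancelˡ a≉0 (trans (inv-r a a≉0) (sym az≈1))

  invFact-0 : invFactℕ 0 ≈ 1#
  invFact-0 = inv-unique _ (trans (*-identityʳ _) (+-identityʳ 1#))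

  invFact-suc : ∀ k → ιℕ (suc k) * invFactℕ (suc k) ≈ invFactℕ k
  invFact-suc k = sym (inv-unique _ (begin
    ιℕ (k !) * (ιℕ (suc k) * invFactℕ (suc k))   ≈⟨ *-assoc _ _ _ ⟨
    (ιℕ (k !) * ιℕ (suc k)) * invFactℕ (suc k)   ≈⟨ *-congʳ (*-comm _ _) ⟩
    (ιℕ (suc k) * ιℕ (k !)) * invFactℕ (suc k)   ≈⟨ *-congʳ (ιℕ-* (suc k) (k !)) ⟨
    ιℕ (suc k !) * invFactℕ (suc k)              ≈⟨ inv-r _ _ ⟩
    1#                                           ∎))

  sum0-cong : ∀ n {g h : ℕ → Carrier} → (∀ i → i ℕ.≤ n → g i ≈ h i) → sum0 n g ≈ sum0 n h
  sum0-cong zero    g≈h = g≈h 0 z≤n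
  sum0-cong (suc n) g≈h = +-cong (sum0-cong n (λ i i≤n → g≈h i (ℕP.m≤n⇒m≤1+n i≤n))) (g≈h (suc n) ℕP.≤-refl)

  sum0-+ : ∀ n (g h : ℕ → Carrier) → sum0 n (λ i → g i + h i) ≈ sum0 n g + sum0 n h
  sum0-+ zero    g h = refl
  sum0-+ (suc n) g h = trans (+-congʳ (sum0-+ n g h))
    (solve 4 (λ a b x y → (a :+ b) :+ (x :+ y) := (a :+ x) :+ (b :+ y)) refl _ _ _ _)

  sum0-- : ∀ n (g h : ℕ → Carrier) → sum0 n (λ i → g i - h i) ≈ sum0 n g - sum0 n h
  sum0-- zero    g h = refl
  sum0-- (suc n) g h = trans (+-congʳ (sum0-- n g h))
    (solve 4 (λ a b x y → (a :- b) :+ (x :- y) := (a :+ x) :- (b :+ y)) refl _ _ _ _)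

  sum0-*ˡ : ∀ n a (g : ℕ → Carrier) → sum0 n (λ i → a * g i) ≈ a * sum0 n g
  sum0-*ˡ zero    a g = refl
  sum0-*ˡ (suc n) a g = trans (+-congʳ (sum0-*ˡ n a g)) (sym (distribˡ _ _ _))

  sum0-*ʳ : ∀ n a (g : ℕ → Carrier) → sum0 n (λ i → g i * a) ≈ sum0 n g * a
  sum0-*ʳ n a g = trans (sum0-cong n (λ i _ → *-comm _ _)) (trans (sum0-*ˡ n a g) (*-comm _ _))

  sum0-zero : ∀ n (g : ℕ → Carrier) → (∀ i → g i ≈ 0#) → sum0 n g ≈ 0#
  sum0-zero zero    g g≈0 = g≈0 0
  sum0-zero (suc n) g g≈0 = trans (+-cong (sum0-zero n g g≈0) (g≈0 (suc n))) (+-identityʳ 0#)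

  sum0-peel : ∀ n (g : ℕ → Carrier) → sum0 (suc n) g ≈ g 0 + sum0 n (λ i → g (suc i))
  sum0-peel zero    g = refl
  sum0-peel (suc n) g = trans (+-congʳ (sum0-peel n g)) (+-assoc _ _ _)

  sum0-triangle : ∀ n (F : ℕ → ℕ → Carrier) →
    sum0 n (λ k → sum0 k (λ i → F i k)) ≈ sum0 n (λ i → sum0 (n ℕ.∸ i) (λ j → F i (i ℕ.+ j)))
  sum0-triangle zero    F = refl
  sum0-triangle (suc n) F = begin
    sum0 n (λ k → sum0 k (λ i → F i k)) + (sum0 n (λ i → F i (suc n)) + F (suc n) (suc n))
      ≈⟨ +-congʳ (sum0-triangle n F) ⟩
    rows n + (sum0 n (λ i → F i (suc n)) + F (suc n) (suc n))
      ≈⟨ +-assoc _ _ _ ⟨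
    (rows n + sum0 n (λ i → F i (suc n))) + F (suc n) (suc n)
      ≈⟨ +-cong (sym (sum0-+ n _ _)) diagonal ⟩
    sum0 n (λ i → row n i + F i (suc n)) + row (suc n) (suc n)
      ≈⟨ +-congʳ (sum0-cong n (λ i i≤n → sym (row-suc i i≤n))) ⟩
    rows (suc n) ∎
    where
    row : ℕ → ℕ → Carrier
    row m i = sum0 (m ℕ.∸ i) (λ j → F i (i ℕ.+ j))
    rows : ℕ → Carrier
    rows m = sum0 m (row m)
    diagonal : F (suc n) (suc n) ≈ row (suc n) (suc n)
    diagonal rewrite ℕP.n∸n≡0 n | ℕP.+-identityʳ n = refl
    row-suc : ∀ i → i ℕ.≤ n → row (suc n) i ≈ row n i + F i (suc n)
    row-suc i i≤n rewrite ℕP.+-∸-assoc 1 i≤n =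
      +-congˡ (reflexive (P.cong (F i) (P.trans (ℕP.+-suc i (n ℕ.∸ i)) (P.cong suc (ℕP.m+[n∸m]≡n i≤n)))))

  X : PS → PS
  X F zero    = 0#
  X F (suc n) = F n

  δ : PS → PS
  δ F n = ιℕ (suc n) * F (suc n)

  infixr 7 _·_
  _·_ : Carrier → PS → PS
  (a · F) n = a * F n

  oneMinusX : PS → PS
  oneMinusX F n = F n - X F n

  X-cong : ∀ {F G} → F ≋ G → X F ≋ X G
  X-cong F≋G zero    = refl
  X-cong F≋G (suc n) = F≋G n

  X-⊕ : ∀ F G → X (F ⊕ G) ≋ (X F ⊕ X G)
  X-⊕ F G zero    = sym (+-identityʳ 0#)
  X-⊕ F G (suc n) = refl

  X-δ : ∀ F n → X (δ F) n ≈ ιℕ n * F n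
  X-δ F zero    = sym (zeroˡ _)
  X-δ F (suc n) = refl

  ⊛-cong : ∀ A A′ B B′ → A ≋ A′ → B ≋ B′ → (A ⊛ B) ≋ (A′ ⊛ B′)
  ⊛-cong A A′ B B′ A≋A′ B≋B′ n = sum0-cong n (λ i _ → *-cong (A≋A′ i) (B≋B′ (n ℕ.∸ i)))

  ⊛-distribʳ : ∀ A B C → ((A ⊕ B) ⊛ C) ≋ ((A ⊛ C) ⊕ (B ⊛ C))
  ⊛-distribʳ A B C n = trans (sum0-cong n (λ i _ → distribʳ _ _ _)) (sum0-+ n _ _)

  ⊛-distribˡ : ∀ A B C → (A ⊛ (B ⊕ C)) ≋ ((A ⊛ B) ⊕ (A ⊛ C))
  ⊛-distribˡ A B C n = trans (sum0-cong n (λ i _ → distribˡ _ _ _)) (sum0-+ n _ _)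

  ⊛-scaleˡ : ∀ a A B → ((a · A) ⊛ B) ≋ (a · (A ⊛ B))
  ⊛-scaleˡ a A B n = trans (sum0-cong n (λ i _ → *-assoc _ _ _)) (sum0-*ˡ n a _)

  ⊛-scaleʳ : ∀ a A B → (A ⊛ (a · B)) ≋ (a · (A ⊛ B))
  ⊛-scaleʳ a A B n = trans (sum0-cong n (λ i _ → solve 3 (λ x y z → x :* (y :* z) := y :* (x :* z)) refl _ _ _))
                           (sum0-*ˡ n a _)

  ⊛-Xˡ : ∀ A B → (X A ⊛ B) ≋ X (A ⊛ B)
  ⊛-Xˡ A B zero    = zeroˡ _
  ⊛-Xˡ A B (suc n) = trans (sum0-peel n _) (trans (+-congʳ (zeroˡ _)) (+-identityˡ _))

  ⊛-Xʳ : ∀ A B → (A ⊛ X B) ≋ X (A ⊛ B)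
  ⊛-Xʳ A B zero    = zeroʳ _
  ⊛-Xʳ A B (suc n) =
    trans (+-cong (sum0-cong n (λ i i≤n → *-congˡ (reflexive (P.cong (X B) (ℕP.+-∸-assoc 1 i≤n))))) top)
          (+-identityʳ _)
    where
    top : A (suc n) * X B (n ℕ.∸ n) ≈ 0#
    top rewrite ℕP.n∸n≡0 n = zeroʳ _

  ⊛-oneMinusXˡ : ∀ A B → (oneMinusX A ⊛ B) ≋ oneMinusX (A ⊛ B)
  ⊛-oneMinusXˡ A B n = begin
    sum0 n (λ i → (A i - X A i) * B (n ℕ.∸ i))
      ≈⟨ sum0-cong n (λ i _ → solve 3 (λ a x b → (a :- x) :* b := a :* b :- x :* b) refl _ _ _) ⟩
    sum0 n (λ i → A i * B (n ℕ.∸ i) - X A i * B (n ℕ.∸ i))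
      ≈⟨ sum0-- n _ _ ⟩
    (A ⊛ B) n - (X A ⊛ B) n
      ≈⟨ +-congˡ (-‿cong (⊛-Xˡ A B n)) ⟩
    oneMinusX (A ⊛ B) n ∎

  ⊛-identityˡ : ∀ F → (const 1# ⊛ F) ≋ F
  ⊛-identityˡ F zero    = *-identityˡ _
  ⊛-identityˡ F (suc n) = begin
    sum0 (suc n) (λ i → const 1# i * F (suc n ℕ.∸ i))      ≈⟨ sum0-peel n _ ⟩
    1# * F (suc n) + sum0 n (λ i → 0# * F (n ℕ.∸ i))       ≈⟨ +-cong (*-identityˡ _) (sum0-zero n _ (λ _ → zeroˡ _)) ⟩
    F (suc n) + 0#                                         ≈⟨ +-identityʳ _ ⟩
    F (suc n)                                              ∎

  ⊛-assoc : ∀ A B C → (A ⊛ (B ⊛ C)) ≋ ((A ⊛ B) ⊛ C)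
  ⊛-assoc A B C n = sym (begin
    sum0 n (λ k → sum0 k (λ i → A i * B (k ℕ.∸ i)) * C (n ℕ.∸ k))
      ≈⟨ sum0-cong n (λ k _ → sym (sum0-*ʳ k _ _)) ⟩
    sum0 n (λ k → sum0 k (λ i → F i k))
      ≈⟨ sum0-triangle n F ⟩
    sum0 n (λ i → sum0 (n ℕ.∸ i) (λ j → F i (i ℕ.+ j)))
      ≈⟨ sum0-cong n (λ i _ → trans (sum0-cong (n ℕ.∸ i) (λ j _ → reassoc i j)) (sum0-*ˡ (n ℕ.∸ i) (A i) _)) ⟩
    sum0 n (λ i → A i * sum0 (n ℕ.∸ i) (λ j → B j * C ((n ℕ.∸ i) ℕ.∸ j))) ∎)
    where
    F : ℕ → ℕ → Carrier
    F i k = A i * B (k ℕ.∸ i) * C (n ℕ.∸ k)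
    reassoc : ∀ i j → F i (i ℕ.+ j) ≈ A i * (B j * C ((n ℕ.∸ i) ℕ.∸ j))
    reassoc i j rewrite ℕP.m+n∸m≡n i j | ℕP.∸-+-assoc n i j = *-assoc _ _ _

  ⊛-divXPow : ∀ s A G → (∀ i → i ℕ.< s → G i ≈ 0#) → divXPow s (A ⊛ G) ≋ (A ⊛ divXPow s G)
  ⊛-divXPow zero A G _ n = trans (reflexive (P.cong (A ⊛ G) (ℕP.+-identityʳ n)))
    (⊛-cong A A G (divXPow 0 G) (λ _ → refl) (λ m → reflexive (P.cong G (P.sym (ℕP.+-identityʳ m)))) n)
  ⊛-divXPow (suc s) A G G<s≈0 n = begin
    (A ⊛ G) (n ℕ.+ suc s)         ≡⟨ P.cong (A ⊛ G) (ℕP.+-suc n s) ⟩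
    (A ⊛ G) (suc n ℕ.+ s)         ≈⟨ ⊛-divXPow s A G (λ i i<s → G<s≈0 i (ℕP.m≤n⇒m≤1+n i<s)) (suc n) ⟩
    (A ⊛ divXPow s G) (suc n)     ≈⟨ ⊛-cong A A _ _ (λ _ → refl) shifted (suc n) ⟩
    (A ⊛ X G′) (suc n)            ≈⟨ ⊛-Xʳ A G′ (suc n) ⟩
    (A ⊛ G′) n                    ∎
    where
    G′ = divXPow (suc s) G
    shifted : divXPow s G ≋ X G′
    shifted zero    = G<s≈0 s ℕP.≤-refl
    shifted (suc m) = reflexive (P.cong G (P.sym (ℕP.+-suc m s)))

  leibniz : ∀ A B → δ (A ⊛ B) ≋ ((δ A ⊛ B) ⊕ (A ⊛ δ B))
  leibniz A B n = begin
    ιℕ (suc n) * sum0 (suc n) h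
      ≈⟨ sum0-*ˡ (suc n) _ _ ⟨
    sum0 (suc n) (λ i → ιℕ (suc n) * h i)
      ≈⟨ sum0-cong (suc n) (λ i i≤n → trans (*-congʳ (split i≤n)) (distribʳ _ _ _)) ⟩
    sum0 (suc n) (λ i → ιℕ i * h i + ιℕ (suc n ℕ.∸ i) * h i)
      ≈⟨ sum0-+ (suc n) _ _ ⟩
    sum0 (suc n) (λ i → ιℕ i * h i) + sum0 (suc n) (λ i → ιℕ (suc n ℕ.∸ i) * h i)
      ≈⟨ +-cong derivative-left derivative-right ⟩
    (δ A ⊛ B) n + (A ⊛ δ B) n ∎
    where
    h : ℕ → Carrier
    h i = A i * B (suc n ℕ.∸ i)
    split : ∀ {i m} → i ℕ.≤ m → ιℕ m ≈ ιℕ i + ιℕ (m ℕ.∸ i)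
    split {i} {m} i≤m = trans (reflexive (P.cong ιℕ (P.sym (ℕP.m+[n∸m]≡n i≤m)))) (ιℕ-+ i (m ℕ.∸ i))
    derivative-left : sum0 (suc n) (λ i → ιℕ i * h i) ≈ (δ A ⊛ B) n
    derivative-left = trans (sum0-peel n _) (trans (+-congʳ (zeroˡ _))
                        (trans (+-identityˡ _) (sum0-cong n (λ i _ → sym (*-assoc _ _ _)))))
    top : ιℕ (n ℕ.∸ n) * h (suc n) ≈ 0#
    top rewrite ℕP.n∸n≡0 n = zeroˡ _
    inner : ∀ i → i ℕ.≤ n → ιℕ (suc n ℕ.∸ i) * h i ≈ A i * δ B (n ℕ.∸ i)
    inner i i≤n rewrite ℕP.+-∸-assoc 1 i≤n = solve 3 (λ x y z → x :* (y :* z) := y :* (x :* z)) refl _ _ _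
    derivative-right : sum0 (suc n) (λ i → ιℕ (suc n ℕ.∸ i) * h i) ≈ (A ⊛ δ B) n
    derivative-right = trans (+-cong (sum0-cong n inner) top) (+-identityʳ _)

  -- First-order equations  (1 - x) Y′ = H.

  Solves : PS → PS → Set ℓ
  Solves Y H = ∀ n → δ Y n ≈ X (δ Y) n + H n

  solves-recurrence : ∀ {Y H} → Solves Y H → ∀ n → ιℕ (suc n) * Y (suc n) ≈ ιℕ n * Y n + H n
  solves-recurrence {Y} sol n = trans (sol n) (+-congʳ (X-δ Y n))

  -- In characteristic 0 the recurrence determines Y from Y(0), provided the
  -- n-th coefficient of H depends only on the n-th coefficient of Y.
  solves-unique : ∀ {Y Z HY HZ} → Solves Y HY → Solves Z HZ →
                  (∀ n → Y n ≈ Z n → HY n ≈ HZ n) → Y 0 ≈ Z 0 → Y ≋ Z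
  solves-unique solY solZ local Y0≈Z0 zero    = Y0≈Z0
  solves-unique {Y} {Z} {HY} {HZ} solY solZ local Y0≈Z0 (suc n) = *-cancelˡ (ch n) (begin
    ιℕ (suc n) * Y (suc n)   ≈⟨ solves-recurrence {Y = Y} solY n ⟩
    ιℕ n * Y n + HY n        ≈⟨ +-cong (*-congˡ Yn≈Zn) (local n Yn≈Zn) ⟩
    ιℕ n * Z n + HZ n        ≈⟨ solves-recurrence {Y = Z} solZ n ⟨
    ιℕ (suc n) * Z (suc n)   ∎)
    where Yn≈Zn = solves-unique solY solZ local Y0≈Z0 n

  solves-⊛ : ∀ {A B HA HB} → Solves A HA → Solves B HB → Solves (A ⊛ B) ((HA ⊛ B) ⊕ (A ⊛ HB))
  solves-⊛ {A} {B} {HA} {HB} solA solB n = begin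
    δ (A ⊛ B) n
      ≈⟨ leibniz A B n ⟩
    (δ A ⊛ B) n + (A ⊛ δ B) n
      ≈⟨ +-cong (⊛-cong (δ A) (X (δ A) ⊕ HA) B B solA (λ _ → refl) n)
                (⊛-cong A A (δ B) (X (δ B) ⊕ HB) (λ _ → refl) solB n) ⟩
    ((X (δ A) ⊕ HA) ⊛ B) n + (A ⊛ (X (δ B) ⊕ HB)) n
      ≈⟨ +-cong (⊛-distribʳ (X (δ A)) HA B n) (⊛-distribˡ A (X (δ B)) HB n) ⟩
    ((X (δ A) ⊛ B) n + (HA ⊛ B) n) + ((A ⊛ X (δ B)) n + (A ⊛ HB) n)
      ≈⟨ +-cong (+-congʳ (⊛-Xˡ (δ A) B n)) (+-congʳ (⊛-Xʳ A (δ B) n)) ⟩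
    (X (δ A ⊛ B) n + (HA ⊛ B) n) + (X (A ⊛ δ B) n + (A ⊛ HB) n)
      ≈⟨ solve 4 (λ a h b k → (a :+ h) :+ (b :+ k) := (a :+ b) :+ (h :+ k)) refl _ _ _ _ ⟩
    (X (δ A ⊛ B) n + X (A ⊛ δ B) n) + ((HA ⊛ B) n + (A ⊛ HB) n)
      ≈⟨ +-congʳ (trans (X-cong (leibniz A B) n) (X-⊕ (δ A ⊛ B) (A ⊛ δ B) n)) ⟨
    X (δ (A ⊛ B)) n + ((HA ⊛ B) n + (A ⊛ HB) n) ∎

  solves-of-δ : ∀ {Y G} → δ Y ≋ G → Solves Y (oneMinusX G)
  solves-of-δ {Y} {G} δY≋G n = begin
    δ Y n                    ≈⟨ δY≋G n ⟩
    G n                      ≈⟨ solve 2 (λ g x → g := x :+ (g :- x)) refl _ _ ⟩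
    X G n + (G n - X G n)    ≈⟨ +-congʳ (X-cong δY≋G n) ⟨
    X (δ Y) n + oneMinusX G n ∎

  solves-const : ∀ a → Solves (const a) (λ _ → 0#)
  solves-const a n = trans (zeroʳ _) (sym (trans (+-identityʳ _) (X-δ0 n)))
    where
    X-δ0 : ∀ n → X (δ (const a)) n ≈ 0#
    X-δ0 zero    = refl
    X-δ0 (suc n) = zeroʳ _

  binomial-0 : ∀ a → oneMinusXPow a 0 ≈ 1#
  binomial-0 a = trans (*-identityˡ _) (trans (*-identityˡ _) invFact-0)

  binomial-solves : ∀ a → Solves (oneMinusXPow a) ((- a) · oneMinusXPow a)
  binomial-solves a n = begin
    ιℕ (suc n) * (- s * ((Fa * (a - ιℕ n)) * I1))
      ≈⟨ solve 5 (λ m s F b I → m :* (:- s :* ((F :* b) :* I)) := (:- s :* (F :* b)) :* (m :* I)) refl _ _ _ _ _ ⟩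
    (- s * (Fa * (a - ιℕ n))) * (ιℕ (suc n) * I1)
      ≈⟨ *-congˡ (invFact-suc n) ⟩
    (- s * (Fa * (a - ιℕ n))) * invFactℕ n
      ≈⟨ solve 5 (λ s F a i I → (:- s :* (F :* (a :- i))) :* I := i :* (s :* (F :* I)) :+ (:- a) :* (s :* (F :* I))) refl _ _ _ _ _ ⟩
    ιℕ n * B n + (- a) * B n
      ≈⟨ +-congʳ (X-δ B n) ⟨
    X (δ B) n + (- a) * B n ∎
    where
    B = oneMinusXPow a
    s = sign n
    Fa = falling a n
    I1 = invFactℕ (suc n)

  -- (1 - x)^a (1 - x)^b = (1 - x)^(a+b): both sides solve (1 - x) Y′ = -(a+b) Y.
  binomial-+ : ∀ a b → (oneMinusXPow a ⊛ oneMinusXPow b) ≋ oneMinusXPow (a + b)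
  binomial-+ a b = solves-unique {Y = A ⊛ B} {Z = oneMinusXPow (a + b)}
    (solves-⊛ {A = A} {B = B} (binomial-solves a) (binomial-solves b)) (binomial-solves (a + b))
    local (trans (*-cong (binomial-0 a) (binomial-0 b)) (trans (*-identityˡ 1#) (sym (binomial-0 (a + b)))))
    where
    A = oneMinusXPow a
    B = oneMinusXPow b
    local : ∀ n → (A ⊛ B) n ≈ oneMinusXPow (a + b) n →
            (((- a) · A) ⊛ B) n + (A ⊛ ((- b) · B)) n ≈ (- (a + b)) * oneMinusXPow (a + b) n
    local n AB≈C = begin
      (((- a) · A) ⊛ B) n + (A ⊛ ((- b) · B)) n  ≈⟨ +-cong (⊛-scaleˡ (- a) A B n) (⊛-scaleʳ (- b) A B n) ⟩
      (- a) * (A ⊛ B) n + (- b) * (A ⊛ B) n      ≈⟨ solve 3 (λ a b y → (:- a) :* y :+ (:- b) :* y := (:- (a :+ b)) :* y) refl a b _ ⟩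
      (- (a + b)) * (A ⊛ B) n                     ≈⟨ *-congˡ AB≈C ⟩
      (- (a + b)) * oneMinusXPow (a + b) n        ∎

  binomial-zero : ∀ {a} → a ≈ 0# → oneMinusXPow a ≋ const 1#
  binomial-zero {a} a≈0 = solves-unique {Y = oneMinusXPow a} {Z = const 1#} (binomial-solves a) (solves-const 1#)
    (λ n _ → trans (*-congʳ (trans (-‿cong a≈0) -0#≈0#)) (zeroˡ _)) (binomial-0 a)
    where open import Algebra.Properties.Ring ring using (-0#≈0#)

  falling-vanish : ∀ {n k} → n ℕ.< k → falling (ιℕ n) k ≈ 0#
  falling-vanish {n} {suc k} (s≤s n≤k) with ℕP.m≤n⇒m<n∨m≡n n≤k
  ... | inj₁ n<k    = trans (*-congʳ (falling-vanish n<k)) (zeroˡ _)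
  ... | inj₂ P.refl = trans (*-congˡ (-‿inverseʳ _)) (zeroʳ _)

  binomial-1 : oneMinusXPow (ιℕ 1) ≋ oneMinusX (const 1#)
  binomial-1 zero          = trans (binomial-0 (ιℕ 1)) (solve 1 (λ o → o := o :- con (+ 0)) refl 1#)
  binomial-1 (suc zero)    = begin
    - 1# * ((1# * (ιℕ 1 - 0#)) * invFactℕ 1)  ≈⟨ *-congˡ (*-congʳ (solve 1 (λ o → o :* (con (+ 1) :- con (+ 0)) := con (+ 1) :* o) refl 1#)) ⟩
    - 1# * ((ιℕ 1 * 1#) * invFactℕ 1)         ≈⟨ *-congˡ (trans (solve 3 (λ m o i → (m :* o) :* i := (m :* i) :* o) refl _ _ _) (*-congʳ (invFact-suc 0))) ⟩
    - 1# * (invFactℕ 0 * 1#)                  ≈⟨ *-congˡ (trans (*-identityʳ _) invFact-0) ⟩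
    - 1# * 1#                                 ≈⟨ solve 1 (λ o → :- o :* o := con (+ 0) :- o :* o) refl 1# ⟩
    0# - 1# * 1#                              ≈⟨ +-congˡ (-‿cong (*-identityʳ 1#)) ⟩
    0# - 1#                                   ∎
  binomial-1 (suc (suc k)) = begin
    sign (suc (suc k)) * (falling (ιℕ 1) (suc (suc k)) * invFactℕ (suc (suc k)))
      ≈⟨ *-congˡ (*-congʳ (falling-vanish {1} {suc (suc k)} (s≤s (s≤s z≤n)))) ⟩
    sign (suc (suc k)) * (0# * invFactℕ (suc (suc k)))
      ≈⟨ solve 2 (λ s i → s :* (con (+ 0) :* i) := con (+ 0) :- con (+ 0)) refl _ _ ⟩
    0# - 0#   ∎

  binomial-1-⊛ : ∀ F → (oneMinusXPow (ιℕ 1) ⊛ F) ≋ oneMinusX F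
  binomial-1-⊛ F n = begin
    (oneMinusXPow (ιℕ 1) ⊛ F) n      ≈⟨ ⊛-cong _ _ F F binomial-1 (λ _ → refl) n ⟩
    (oneMinusX (const 1#) ⊛ F) n     ≈⟨ ⊛-oneMinusXˡ (const 1#) F n ⟩
    oneMinusX (const 1# ⊛ F) n       ≈⟨ +-cong (⊛-identityˡ F n) (-‿cong (X-cong (⊛-identityˡ F) n)) ⟩
    oneMinusX F n                    ∎

  mulXPow-≋ : ∀ m (A F : PS) → (∀ n → n ℕ.< m → A n ≈ 0#) → (∀ k → A (k ℕ.+ m) ≈ F k) → A ≋ mulXPow m F
  mulXPow-≋ m A F below above n with n ℕ.<ᵇ m in n<ᵇm
  ... | true  = below n (ℕP.<ᵇ⇒< n m (P.subst T (P.sym n<ᵇm) tt))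
  ... | false = trans (reflexive (P.cong A (P.sym (ℕP.m∸n+n≡m m≤n)))) (above (n ℕ.∸ m))
    where
    m≤n : m ℕ.≤ n
    m≤n = ℕP.≮⇒≥ (λ n<m → P.subst T n<ᵇm (ℕP.<⇒<ᵇ n<m))

  δ-integral : ∀ a F → δ (const a ⊕ integral F) ≋ F
  δ-integral a F n = begin
    ιℕ (suc n) * (0# + F n * invSuc n)   ≈⟨ solve 3 (λ m y i → m :* (con (+ 0) :+ y :* i) := y :* (m :* i)) refl _ _ _ ⟩
    F n * (ιℕ (suc n) * invSuc n)        ≈⟨ *-congˡ (inv-r _ (ch n)) ⟩
    F n * 1#                             ≈⟨ *-identityʳ _ ⟩
    F n                                  ∎

  invFact-⊖-< : ∀ {m n} → m ℕ.< n → invFact (m ⊖ n) ≡ 0#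
  invFact-⊖-< {zero}  {suc n} _ = P.refl
  invFact-⊖-< {suc m} {suc n} (s≤s m<n) rewrite ℤP.[1+m]⊖[1+n]≡m⊖n m n = invFact-⊖-< m<n

-- The identity for fixed p, f and d = -D with D = e + 1.
module Identity {c ℓ : Level} (K : Field c ℓ) (ch : CharZero K)
                (p : Field.Carrier K) (f : ℕ → Field.Carrier K) (e : ℕ) where
  open Field K hiding (zero)
  open PowerSeries K ch
  open IntegerCoefficients K
  open FormalSeries K ch
  open import Relation.Binary.Reasoning.Setoid setoid

  D : ℕ
  D = suc e

  d : Carrier
  d = ιℤ -[1+ e ]

  U V : PS
  U = oneMinusXPow (d - p)
  V = oneMinusXPow (p - d - 1#)

  μ : Carrier
  μ = - (d - p)

  LHS G Q J : PS
  LHS = seriesFrom1 (λ n → poch p n * invFact (+ n ℤ.+ -[1+ e ]) * sum1 n f)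
  G   = seriesFrom1 (λ n → poch p n * invFact (+ n ℤ.+ -[1+ e ] ℤ.- + 1) * f n)
  Q   = divXPow (suc D) (V ⊛ G)
  J   = const (poch p D * sum1 D f) ⊕ integral Q

  -- the coefficients of LHS shifted down by D, and of the integrand series
  M g : PS
  M m = poch p (m ℕ.+ D) * invFactℕ m * sum1 (m ℕ.+ D) f
  g m = poch p (suc m ℕ.+ D) * invFactℕ m * f (suc m ℕ.+ D)

  vanishing : ∀ a b {z} → z ≡ 0# → a * z * b ≈ 0#
  vanishing a b P.refl = trans (*-congʳ (zeroʳ a)) (zeroˡ b)

  LHS-below : ∀ n → n ℕ.< D → LHS n ≈ 0#
  LHS-below zero    _  = refl
  LHS-below (suc j) lt = vanishing _ _ (invFact-⊖-< lt)

  LHS-above : ∀ m → LHS (m ℕ.+ D) ≈ M m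
  LHS-above m rewrite ℕP.+-suc m e =
    reflexive (P.cong (λ z → poch p (suc m ℕ.+ e) * invFact z * sum1 (suc m ℕ.+ e) f)
      (P.subst (λ k → k ⊖ D ≡ + m) (ℕP.+-suc m e) (⊖-shift m D)))

  G-below : ∀ i → i ℕ.< suc D → G i ≈ 0#
  G-below zero    _  = refl
  G-below (suc j) lt = vanishing _ _ (P.trans (P.cong invFact (ℤP.distribˡ-⊖-+-neg 0 (suc j) D))
                                              (invFact-⊖-< (P.subst (suc j ℕ.<_) (P.sym (ℕP.+-identityʳ (suc D))) lt)))

  G-above : divXPow (suc D) G ≋ g
  G-above n rewrite ℕP.+-suc n D =
    reflexive (P.cong (λ z → poch p (suc n ℕ.+ D) * invFact (z ℤ.- + 1) * f (suc n ℕ.+ D)) (⊖-shift (suc n) D))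

  Q≋Vg : Q ≋ (V ⊛ g)
  Q≋Vg n = trans (⊛-divXPow (suc D) V G G-below n) (⊛-cong V V _ g (λ _ → refl) G-above n)

  M-solves : Solves M ((μ · M) ⊕ g)
  M-solves n = begin
    ιℕ (suc n) * ((P * (p + z)) * I1 * (S + y))
      ≈⟨ solve 7 (λ m P p z I S y → m :* ((P :* (p :+ z)) :* I :* (S :+ y)) := ((P :* (p :+ z)) :* (S :+ y)) :* (m :* I)) refl _ _ _ _ _ _ _ ⟩
    ((P * (p + z)) * (S + y)) * (ιℕ (suc n) * I1)
      ≈⟨ *-congˡ (invFact-suc n) ⟩
    ((P * (p + z)) * (S + y)) * I0
      ≈⟨ solve 6 (λ P p z S y I → ((P :* (p :+ z)) :* (S :+ y)) :* I := (P :* (p :+ z)) :* I :* S :+ (P :* (p :+ z)) :* I :* y) refl _ _ _ _ _ _ ⟩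
    (P * (p + z)) * I0 * S + g n
      ≈⟨ +-congʳ (*-congʳ (*-congʳ (*-congˡ (+-congˡ (ιℕ-+ n D))))) ⟩
    (P * (p + (ιℕ n + ιℕ D))) * I0 * S + g n
      ≈⟨ solve 7 (λ P p k q I S y → (P :* (p :+ (k :+ q))) :* I :* S :+ y := k :* (P :* I :* S) :+ ((:- (:- q :- p)) :* (P :* I :* S) :+ y)) refl _ _ _ _ _ _ _ ⟩
    ιℕ n * M n + (μ * M n + g n)
      ≈⟨ +-congʳ (X-δ M n) ⟨
    X (δ M) n + (μ * M n + g n) ∎
    where
    P = poch p (n ℕ.+ D)
    z = ιℕ (n ℕ.+ D)
    I1 = invFactℕ (suc n)
    I0 = invFactℕ n
    S = sum1 (n ℕ.+ D) f
    y = f (suc (n ℕ.+ D))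

  J-solves : Solves J (oneMinusX Q)
  J-solves = solves-of-δ {Y = J} (δ-integral (poch p D * sum1 D f) Q)

  -- U (1 - x) V = (1 - x)^{(d - p) + 1 + (p - d - 1)} = 1, hence U (1 - x) Q = g.
  U-oneMinusX-Q : (U ⊛ oneMinusX Q) ≋ g
  U-oneMinusX-Q n = begin
    (U ⊛ oneMinusX Q) n              ≈⟨ ⊛-cong U U _ _ (λ _ → refl) (λ k → +-cong (Q≋Vg k) (-‿cong (X-cong Q≋Vg k))) n ⟩
    (U ⊛ oneMinusX (V ⊛ g)) n        ≈⟨ ⊛-cong U U _ _ (λ _ → refl) (binomial-1-⊛ (V ⊛ g)) n ⟨
    (U ⊛ (O ⊛ (V ⊛ g))) n            ≈⟨ ⊛-assoc U O (V ⊛ g) n ⟩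
    ((U ⊛ O) ⊛ (V ⊛ g)) n            ≈⟨ ⊛-assoc (U ⊛ O) V g n ⟩
    (((U ⊛ O) ⊛ V) ⊛ g) n            ≈⟨ ⊛-cong _ _ g g UOV≋1 (λ _ → refl) n ⟩
    (const 1# ⊛ g) n                 ≈⟨ ⊛-identityˡ g n ⟩
    g n                              ∎
    where
    O = oneMinusXPow (ιℕ 1)
    exponent≈0 : (d - p + ιℕ 1) + (p - d - 1#) ≈ 0#
    exponent≈0 = solve 3 (λ d p o → (d :- p :+ (o :+ con (+ 0))) :+ (p :- d :- o) := con (+ 0)) refl d p 1#
    UOV≋1 : ((U ⊛ O) ⊛ V) ≋ const 1#
    UOV≋1 k = begin
      ((U ⊛ O) ⊛ V) k                                     ≈⟨ ⊛-cong (U ⊛ O) _ V V (binomial-+ (d - p) (ιℕ 1)) (λ _ → refl) k ⟩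
      (oneMinusXPow (d - p + ιℕ 1) ⊛ V) k                  ≈⟨ binomial-+ (d - p + ιℕ 1) (p - d - 1#) k ⟩
      oneMinusXPow ((d - p + ιℕ 1) + (p - d - 1#)) k       ≈⟨ binomial-zero exponent≈0 k ⟩
      const 1# k                                           ∎

  -- U J and M solve the same equation with the same constant term.
  UJ≋M : (U ⊛ J) ≋ M
  UJ≋M = solves-unique {Y = U ⊛ J} {Z = M} (solves-⊛ {A = U} {B = J} (binomial-solves (d - p)) J-solves) M-solves
           same-equation same-start
    where
    same-equation : ∀ n → (U ⊛ J) n ≈ M n → ((((- (d - p)) · U) ⊛ J) ⊕ (U ⊛ oneMinusX Q)) n ≈ μ * M n + g n
    same-equation n UJn≈Mn = +-cong (trans (⊛-scaleˡ (- (d - p)) U J n) (*-congˡ UJn≈Mn)) (U-oneMinusX-Q n)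
    same-start : U 0 * (poch p D * sum1 D f + 0#) ≈ poch p D * invFactℕ 0 * sum1 D f
    same-start = begin
      U 0 * (poch p D * sum1 D f + 0#)    ≈⟨ *-cong (binomial-0 (d - p)) (+-identityʳ _) ⟩
      1# * (poch p D * sum1 D f)          ≈⟨ *-identityˡ _ ⟩
      poch p D * sum1 D f                 ≈⟨ *-congʳ (trans (*-congˡ invFact-0) (*-identityʳ _)) ⟨
      poch p D * invFactℕ 0 * sum1 D f    ∎

  theorem : LHS ≋ mulXPow D (U ⊛ J)
  theorem = mulXPow-≋ D LHS (U ⊛ J) LHS-below (λ m → trans (LHS-above m) (sym (UJ≋M m)))


lemma2 : {c ℓ : Level} (K : Field c ℓ) (ch : CharZero K) →
    let open Field K
        open PowerSeries K ch
    in (p : Carrier) (f : ℕ → Carrier) (d : ℤ) → d < + 0 →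
       seriesFrom1 (λ n → poch p n * invFact (+ n +ℤ d) * sum1 n f)
       ≋
       mulXPow ∣ -ℤ d ∣
         (oneMinusXPow (ιℤ d - p)
          ⊛ (const (poch p ∣ -ℤ d ∣ * sum1 ∣ -ℤ d ∣ f)
             ⊕ integral
                 (divXPow ∣ + 1 -ℤ d ∣
                   (oneMinusXPow (p - ιℤ d - 1#)
                    ⊛ seriesFrom1 (λ n → poch p n * invFact (+ n +ℤ d -ℤ + 1) * f n)))))
lemma2 K ch p f (+ n)    (ℤ.+<+ ())
lemma2 K ch p f -[1+ e ] _ = Identity.theorem K ch p f e
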